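{- For an irreducible tredoku tiling, the number $n_4$ of $4$-tiles satisfies $n_4=0$ or $n_4=1$.
   Context: A tile is a closed rhombus of unit side with interior angles $60^\circ$ and $120^\circ$, placed so that its edges lie on a fixed triangular lattice of the plane. Two tiles are adjacent if they share a full common edge. A run is a maximal sequence $T_1,\dots,T_k$ ($k\ge 2$) of distinct tiles such that $T_i$ and $T_{i+1}$ share an edge $e_i$, all the $e_i$ are parallel, and for $1<i<k$ the edges $e_{i-1},e_i$ are opposite edges of $T_i$. A tredoku tiling is a finite set of $\tau\ge5$ tiles such that: (P1) the adjacency graph on the tiles is connected; (P2) any two tiles are disjoint, meet in exactly one common vertex, or share a full common edge; (P3) after removing any single tile, the remaining tiles are still connected, where two tiles are considered joined if they have nonempty intersection; (P4/P5) every run consists of exactly three tiles; and (no holes) the complement of the union of the tiles is connected. An $i$-tile is a tile adjacent to exactly $i$ other tiles. The spine is the set of $3$-tiles and $4$-tiles; the tiling is irreducible if the spine is connected under adjacency (any two spine tiles are joined by a sequence of spine tiles with consecutive ones adjacent). -}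

module Defs where

open import Data.Nat using (ℕ; _≤_)
open import Data.Integer using (ℤ; +_; -[1+_]) renaming (_+_ to _+ℤ_)
open import Data.Fin using (Fin; zero; suc)
open import Data.Product using (Σ; ∃; ∃-syntax; _×_; _,_)
open import Data.Sum using (_⊎_)
open import Data.Unit using (⊤)
open import Data.Maybe using (Maybe; just; nothing)
open import Data.List using (List; []; _∷_; _++_; length)
open import Data.List.Membership.Propositional using (_∈_; _∉_)
open import Data.List.Relation.Unary.All using (All)
open import Data.List.Relation.Unary.Unique.Propositional using (Unique)
open import Relation.Binary.PropositionalEquality using (_≡_; _≢_)
open import Relation.Nullary using (¬_)

-- A lattice point (a , b) stands for  a·u + b·v  with u = (1,0),
-- v = (1/2, √3/2).

Point : Set
Point = ℤ × ℤ

_⊕_ : Point → Point → Point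
(a , b) ⊕ (c , d) = (a +ℤ c , b +ℤ d)

pt : ℤ → ℤ → Point
pt a b = (a , b)

one minusOne : ℤ
one = + 1
minusOne = -[1+ 0 ]

dvec : Fin 3 → Point
dvec zero = pt one (+ 0)
dvec (suc zero) = pt (+ 0) one
dvec (suc (suc zero)) = pt minusOne one

-- A unit lattice segment: from 'src' to 'src ⊕ dvec dir'
-- (every lattice segment has exactly one such representation).
record Edge : Set where
  constructor seg
  field
    src : Point
    dir : Fin 3

tgt : Edge → Point
tgt (seg p d) = p ⊕ dvec d

data Tri : Set where
  up   : Point → Tri
  down : Point → Tri

data Face : Set where
  vtx : Point → Face
  edg : Edge → Face
  tri : Tri → Face

u v w uv : Point
u = pt one (+ 0)
v = pt (+ 0) one
w = pt minusOne one
uv = pt one one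

triVerts : Tri → List Point
triVerts (up q)   = q ∷ (q ⊕ u) ∷ (q ⊕ v) ∷ []
triVerts (down r) = (r ⊕ u) ∷ (r ⊕ uv) ∷ (r ⊕ v) ∷ []

triEdges : Tri → List Edge
triEdges (up q)   = seg q zero ∷ seg q (suc zero) ∷ seg (q ⊕ u) (suc (suc zero)) ∷ []
triEdges (down r) = seg (r ⊕ u) (suc zero) ∷ seg (r ⊕ v) zero ∷ seg (r ⊕ u) (suc (suc zero)) ∷ []

mapL : {A B : Set} → (A → B) → List A → List B
mapL f [] = []
mapL f (x ∷ xs) = f x ∷ mapL f xs

triFaces : Tri → List Face
triFaces t = tri t ∷ mapL edg (triEdges t) ++ mapL vtx (triVerts t)

segFaces : Edge → List Face
segFaces e = edg e ∷ vtx (Edge.src e) ∷ vtx (tgt e) ∷ []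

-- Tiles.  Every 60°/120° lattice rhombus is the union of exactly one
-- 'up' triangle with one of its three edge-neighbouring 'down'
-- triangles; tile (q , k) is  up q ∪ down (partner q k).

Tile : Set
Tile = Point × Fin 3

partner : Point → Fin 3 → Point
partner q zero = q
partner q (suc zero) = q ⊕ pt minusOne (+ 0)
partner q (suc (suc zero)) = q ⊕ pt (+ 0) minusOne

tri₁ tri₂ : Tile → Tri
tri₁ (q , k) = up q
tri₂ (q , k) = down (partner q k)

-- The cells contained in the closed tile.  Since tiles are unions of
-- closed cells, two closed tiles intersect exactly in the union of
-- their common cells.
faces : Tile → List Face
faces T = triFaces (tri₁ T) ++ triFaces (tri₂ T)

-- e is one of the four sides of T (a boundary edge of the rhombus):
-- an edge of exactly one of its two triangles.
IsSide : Edge → Tile → Set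
IsSide e T = (e ∈ triEdges (tri₁ T) × e ∉ triEdges (tri₂ T))
           ⊎ (e ∉ triEdges (tri₁ T) × e ∈ triEdges (tri₂ T))

Common : Tile → Tile → Face → Set
Common T U f = f ∈ faces T × f ∈ faces U

_iff_ : Set → Set → Set
A iff B = (A → B) × (B → A)

Meet : Tile → Tile → Set
Meet T U = ∃[ f ] Common T U f

Adjacent : Tile → Tile → Set
Adjacent T U = T ≢ U × ∃[ e ] (IsSide e T × IsSide e U)

Opposite : Edge → Edge → Tile → Set
Opposite e e' T = IsSide e T × IsSide e' T × e ≢ e' × Edge.dir e ≡ Edge.dir e'

data Reach {A : Set} (P : A → Set) (R : A → A → Set) : A → A → Set where
  here : ∀ {x} → Reach P R x x
  step : ∀ {x y z} → R x y → P y → Reach P R y z → Reach P R x z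

Connected : {A : Set} → (A → Set) → (A → A → Set) → Set
Connected P R = ∀ x y → P x → P y → Reach P R x y

EntryOpp : Maybe Edge → Edge → Tile → Set
EntryOpp nothing  e T = ⊤
EntryOpp (just e') e T = Opposite e' e T

-- Links d m ts es : consecutive tiles T_i, T_{i+1} of ts share the side
-- e_i (listed in es), every e_i has direction d (all parallel), and for
-- inner tiles the entry edge e_{i-1} and exit edge e_i are opposite
-- sides of T_i.  m is the edge by which the first tile was entered.
data Links (d : Fin 3) : Maybe Edge → List Tile → List Edge → Set where
  last : ∀ {m T} → Links d m (T ∷ []) []
  link : ∀ {m T U ts e es} → IsSide e T → IsSide e U → Edge.dir e ≡ d →
         EntryOpp m e T → Links d (just e) (U ∷ ts) es →
         Links d m (T ∷ U ∷ ts) (e ∷ es)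

IsChain : List Tile → List Tile → Set
IsChain tiles ts = 2 ≤ length ts × All (_∈ tiles) ts × Unique ts
                 × ∃[ d ] ∃[ es ] Links d nothing ts es

IsRun : List Tile → List Tile → Set
IsRun tiles ts = IsChain tiles ts ×
  (∀ pre suf → IsChain tiles (pre ++ ts ++ suf) → pre ≡ [] × suf ≡ [])

-- Tredoku tilings.  A finite set of tiles is a duplicate-free list.

InTiling : List Tile → Tile → Set
InTiling tiles T = T ∈ tiles

P2 : Tile → Tile → Set
P2 T U = (∀ f → ¬ Common T U f)
       ⊎ (∃[ p ] ∀ f → Common T U f iff (f ≡ vtx p))
       ⊎ (∃[ e ] (IsSide e T × IsSide e U × (∀ f → Common T U f iff (f ∈ segFaces e))))

Covered : List Tile → Face → Set
Covered tiles f = ∃[ T ] (T ∈ tiles × f ∈ faces T)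

TriAdj : List Tile → Tri → Tri → Set
TriAdj tiles t t' = t ≢ t' × ∃[ e ] (e ∈ triEdges t × e ∈ triEdges t' × ¬ Covered tiles (edg e))

NoHoles : List Tile → Set
NoHoles tiles = Connected (λ t → ¬ Covered tiles (tri t)) (TriAdj tiles)

record Tredoku (tiles : List Tile) : Set where
  field
    distinct : Unique tiles
    atLeast5 : 5 ≤ length tiles
    P1 : Connected (InTiling tiles) Adjacent
    P2-holds : ∀ T U → T ∈ tiles → U ∈ tiles → T ≢ U → P2 T U
    P3 : ∀ T → T ∈ tiles → Connected (λ U → U ∈ tiles × U ≢ T) Meet
    P45 : ∀ ts → IsRun tiles ts → length ts ≡ 3
    noHoles : NoHoles tiles

Degree : List Tile → Tile → ℕ → Set
Degree tiles T i = ∃[ L ] (Unique L × length L ≡ i ×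
                   (∀ U → (U ∈ L) iff (U ∈ tiles × Adjacent T U)))

InSpine : List Tile → Tile → Set
InSpine tiles T = T ∈ tiles × (Degree tiles T 3 ⊎ Degree tiles T 4)

Irreducible : List Tile → Set
Irreducible tiles = Connected (InSpine tiles) Adjacent

-- L lists (without repetition) exactly the 4-tiles; n₄ = length L
FourTiles : List Tile → List Tile → Set
FourTiles tiles L = Unique L × (∀ U → (U ∈ L) iff (U ∈ tiles × Degree tiles U 4))

{-# OPTIONS --safe #-}
module Submission where

-- Let T ≠ T′ be 4-tiles; irreducibility joins them by a path in the spine.  Walking along it from T we
-- keep the invariant that every tile other than T was entered through a side whose opposite side is
-- free (contained in no other tile).  It propagates for two reasons.  A spine tile has at least three
-- neighbours, each on a side of its own, so at most one of its four sides is free.  And runs have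
-- exactly three tiles: if the side of the tile we leave opposite the exit is occupied, the run through
-- the exit ends at the tile we enter, whose side opposite the entry is therefore free.  A 4-tile has
-- no free side, so the only 4-tile the walk can reach is T itself.

open import Defs
open import Data.List using (List; length)
open import Data.Sum using (_⊎_)
open import Relation.Binary.PropositionalEquality using (_≡_)

open import Algebra.Bundles using (AbelianGroup)
open import Data.Nat using (zero; suc; _≤_; _<_; _+_; z≤n; s≤s)
open import Data.Nat.Properties
  using (≤-trans; <-trans; ≤-<-trans; <-irrefl; <⇒≱; ≮⇒≥; m≤m+n; +-suc; +-monoʳ-≤; module ≤-Reasoning)
open import Data.Integer as ℤ using (ℤ; +_; -[1+_]; _-_) renaming (_+_ to _+ℤ_)
open import Data.Integer.Properties using (+-identityʳ; +-assoc; +-comm; i≢suc[i]; +-0-abelianGroup)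
open import Algebra.Properties.Group (AbelianGroup.group +-0-abelianGroup) using (∙-cancelʳ)
open import Data.Integer.Tactic.RingSolver using (solve-∀)
open import Data.Fin as Fin using (Fin; zero; suc)
open import Data.Product using (∃; ∃₂; ∃-syntax; _×_; _,_; proj₁; proj₂)
open import Data.Product.Properties using (≡-dec)
open import Data.Sum using (inj₁; inj₂; [_,_]′)
open import Data.Unit using (tt)
open import Data.Empty using (⊥; ⊥-elim)
open import Data.List using ([]; _∷_; _++_)
open import Data.List.Properties using (length-++; length-++-sucʳ; length-++-≤ˡ; length-++-≤ʳ)
open import Data.List.Relation.Unary.Any using (here; there)
open import Data.List.Relation.Unary.All as All using (All; []; _∷_)
open import Data.List.Relation.Unary.All.Properties as Allₚ using (All¬⇒¬Any)
open import Data.List.Relation.Unary.AllPairs using ([]; _∷_)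
open import Data.List.Relation.Unary.Unique.Propositional using (Unique)
import Data.List.Relation.Unary.Unique.Propositional.Properties as Uniqueₚ
open import Data.List.Membership.Propositional using (_∈_; _∉_)
open import Data.List.Membership.Propositional.Properties using (∈-∃++; ∈-++⁺ˡ; ∈-++⁺ʳ)
open import Function using (_∘_)
open import Relation.Binary.Definitions using (DecidableEquality)
open import Relation.Binary.PropositionalEquality
  using (_≢_; refl; sym; trans; cong; cong₂; subst; ≢-sym; module ≡-Reasoning)
open import Relation.Nullary using (¬_; yes; no)

module _ {A : Set} where

  ∈-++-∷⁻ : ∀ (xs : List A) {x y ys} → y ∈ xs ++ x ∷ ys → y ≢ x → y ∈ xs ++ ys
  ∈-++-∷⁻ []       (here refl) y≢x = ⊥-elim (y≢x refl)
  ∈-++-∷⁻ []       (there y∈)  _   = y∈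
  ∈-++-∷⁻ (_ ∷ xs) (here refl) _   = here refl
  ∈-++-∷⁻ (_ ∷ xs) (there y∈)  y≢x = there (∈-++-∷⁻ xs y∈ y≢x)

  Unique-⊆⇒length≤ : ∀ {xs ys : List A} → Unique xs → All (_∈ ys) xs → length xs ≤ length ys
  Unique-⊆⇒length≤ [] [] = z≤n
  Unique-⊆⇒length≤ {x ∷ xs} (x∉xs ∷ unique) (x∈ys ∷ xs⊆ys) with ∈-∃++ x∈ys
  ... | ys₁ , ys₂ , refl =
    subst (suc (length xs) ≤_) (sym (length-++-sucʳ ys₁ x ys₂))
      (s≤s (Unique-⊆⇒length≤ unique (All.zipWith drop (x∉xs , xs⊆ys))))
    where
      drop : ∀ {y} → x ≢ y × y ∈ ys₁ ++ x ∷ ys₂ → y ∈ ys₁ ++ ys₂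
      drop (x≢y , y∈) = ∈-++-∷⁻ ys₁ y∈ (≢-sym x≢y)

  extension-trivial⊎longer : ∀ (pre xs suf : List A) →
                             (pre ≡ [] × suf ≡ []) ⊎ length xs < length (pre ++ xs ++ suf)
  extension-trivial⊎longer []      xs []        = inj₁ (refl , refl)
  extension-trivial⊎longer []      xs (y ∷ suf) =
    inj₂ (subst (length xs <_) (sym (length-++-sucʳ xs y suf)) (s≤s (length-++-≤ˡ xs)))
  extension-trivial⊎longer (_ ∷ pre) xs suf   =
    inj₂ (s≤s (≤-trans (length-++-≤ˡ xs) (length-++-≤ʳ (xs ++ suf) {pre})))

module _ {A B : Set} (R : A → B → Set) (R-injective : ∀ {x x′ y} → R x y → R x′ y → x ≡ x′) where

  Unique-image : ∀ {xs} → Unique xs → All (λ x → ∃ (R x)) xs →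
                 ∃[ ys ] (Unique ys × length ys ≡ length xs ×
                          All (λ y → ∃[ x ] (x ∈ xs × R x y)) ys)
  Unique-image [] [] = [] , [] , refl , []
  Unique-image {x ∷ xs} (x∉xs ∷ unique) ((y , Rxy) ∷ images) with Unique-image unique images
  ... | ys , unique-ys , length-ys , sources =
    y ∷ ys , All.map fresh sources ∷ unique-ys , cong suc length-ys ,
    (x , here refl , Rxy) ∷ All.map (λ (x′ , x′∈ , Rx′y′) → x′ , there x′∈ , Rx′y′) sources
    where
      fresh : ∀ {y′} → ∃[ x′ ] (x′ ∈ xs × R x′ y′) → y ≢ y′
      fresh (x′ , x′∈xs , Rx′y) refl = All.lookup x∉xs x′∈xs (R-injective Rxy Rx′y)

IsUnit : ℤ → Set
IsUnit z = z ≡ + 1 ⊎ z ≡ -[1+ 0 ]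

unit+unit≢unit : ∀ {m n} → IsUnit m → IsUnit n → ¬ IsUnit (m +ℤ n)
unit+unit≢unit (inj₁ refl) (inj₁ refl) (inj₁ ())
unit+unit≢unit (inj₁ refl) (inj₁ refl) (inj₂ ())
unit+unit≢unit (inj₁ refl) (inj₂ refl) (inj₁ ())
unit+unit≢unit (inj₁ refl) (inj₂ refl) (inj₂ ())
unit+unit≢unit (inj₂ refl) (inj₁ refl) (inj₁ ())
unit+unit≢unit (inj₂ refl) (inj₁ refl) (inj₂ ())
unit+unit≢unit (inj₂ refl) (inj₂ refl) (inj₁ ())
unit+unit≢unit (inj₂ refl) (inj₂ refl) (inj₂ ())

successor-IsUnit : ∀ m {n} → n ≡ m +ℤ + 1 → IsUnit (n - m) × IsUnit (m - n)
successor-IsUnit m refl = inj₁ (m+1-m≡1 m) , inj₂ (m-[m+1]≡-1 m)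
  where
    m+1-m≡1 : ∀ m → m +ℤ + 1 - m ≡ + 1
    m+1-m≡1 = solve-∀
    m-[m+1]≡-1 : ∀ m → m - (m +ℤ + 1) ≡ -[1+ 0 ]
    m-[m+1]≡-1 = solve-∀

no-unit-triangle : ∀ x y z → IsUnit (y - x) → IsUnit (z - y) → ¬ IsUnit (z - x)
no-unit-triangle x y z xy yz xz = unit+unit≢unit yz xy (subst IsUnit (telescope x y z) xz)
  where
    telescope : ∀ x y z → z - x ≡ (z - y) +ℤ (y - x)
    telescope = solve-∀

data Pair : Set where
  first second : Pair

data End : Set where
  lo hi : End

other : End → End
other lo = hi
other hi = lo

pairDir : Fin 3 → Pair → Fin 3
pairDir zero             first  = zero
pairDir zero             second = suc zero
pairDir (suc zero)       first  = zero
pairDir (suc zero)       second = suc (suc zero)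
pairDir (suc (suc zero)) first  = suc zero
pairDir (suc (suc zero)) second = suc (suc zero)

pairDir-injective : ∀ k {p p′} → pairDir k p ≡ pairDir k p′ → p ≡ p′
pairDir-injective _                {first}  {first}  _ = refl
pairDir-injective _                {second} {second} _ = refl
pairDir-injective zero             {first}  {second} ()
pairDir-injective zero             {second} {first}  ()
pairDir-injective (suc zero)       {first}  {second} ()
pairDir-injective (suc zero)       {second} {first}  ()
pairDir-injective (suc (suc zero)) {first}  {second} ()
pairDir-injective (suc (suc zero)) {second} {first}  ()

-- side X p lo and side X p hi are the two sides of X in direction pairDir k p, the hi one on the next
-- lattice line (level-hi).  Source points are spelled exactly as in triEdges, so that membership of a
-- side in the edge list of its triangle is refl.
sideSrc : Point → Fin 3 → Pair → End → Point
sideSrc q zero             first  lo = q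
sideSrc q zero             first  hi = q ⊕ v
sideSrc q zero             second lo = q
sideSrc q zero             second hi = q ⊕ u
sideSrc q (suc zero)       first  lo = q
sideSrc q (suc zero)       first  hi = partner q (suc zero) ⊕ v
sideSrc q (suc zero)       second lo = partner q (suc zero) ⊕ u
sideSrc q (suc zero)       second hi = q ⊕ u
sideSrc q (suc (suc zero)) first  lo = q
sideSrc q (suc (suc zero)) first  hi = partner q (suc (suc zero)) ⊕ u
sideSrc q (suc (suc zero)) second lo = partner q (suc (suc zero)) ⊕ u
sideSrc q (suc (suc zero)) second hi = q ⊕ u

side : Tile → Pair → End → Edge
side (q , k) p end = seg (sideSrc q k p end) (pairDir k p)

-- The lattice lines of direction dir are the level sets of this linear form, so parallel edges lie on
-- a common line iff their levels agree.
level : Edge → ℤ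
level (seg (a , b) zero)             = b
level (seg (a , b) (suc zero))       = a
level (seg (a , b) (suc (suc zero))) = a +ℤ b

level-hi : ∀ X p → level (side X p hi) ≡ level (side X p lo) +ℤ + 1
level-hi ((a , b) , zero)             first  = refl
level-hi ((a , b) , zero)             second = refl
level-hi ((a , b) , suc zero)         first  = cong (_+ℤ + 1) (+-identityʳ b)
level-hi ((a , b) , suc zero)         second = shift a b
  where
    shift : ∀ a b → (a +ℤ + 1) +ℤ (b +ℤ + 0) ≡ ((a +ℤ -[1+ 0 ] +ℤ + 1) +ℤ (b +ℤ + 0 +ℤ + 0)) +ℤ + 1
    shift = solve-∀
level-hi ((a , b) , suc (suc zero))   first  = cong (_+ℤ + 1) (+-identityʳ a)
level-hi ((a , b) , suc (suc zero))   second = shift a b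
  where
    shift : ∀ a b → (a +ℤ + 1) +ℤ (b +ℤ + 0) ≡ ((a +ℤ + 0 +ℤ + 1) +ℤ (b +ℤ -[1+ 0 ] +ℤ + 0)) +ℤ + 1
    shift = solve-∀

lo≢hi : ∀ X p → side X p lo ≢ side X p hi
lo≢hi X p eq = i≢suc[i] (begin
  level (side X p lo)         ≡⟨ cong level eq ⟩
  level (side X p hi)         ≡⟨ level-hi X p ⟩
  level (side X p lo) +ℤ + 1  ≡⟨ +-comm (level (side X p lo)) (+ 1) ⟩
  + 1 +ℤ level (side X p lo)   ∎)
  where open ≡-Reasoning

side-isSide : ∀ X p end → IsSide (side X p end) X
side-isSide X@(q , zero) first lo =
  inj₁ (here refl , All¬⇒¬Any ((λ ()) ∷ lo≢hi X first ∷ (λ ()) ∷ []))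
side-isSide X@(q , zero) first hi =
  inj₂ (All¬⇒¬Any (≢-sym (lo≢hi X first) ∷ (λ ()) ∷ (λ ()) ∷ []) , there (here refl))
side-isSide X@(q , zero) second lo =
  inj₁ (there (here refl) , All¬⇒¬Any (lo≢hi X second ∷ (λ ()) ∷ (λ ()) ∷ []))
side-isSide X@(q , zero) second hi =
  inj₂ (All¬⇒¬Any ((λ ()) ∷ ≢-sym (lo≢hi X second) ∷ (λ ()) ∷ []) , here refl)
side-isSide X@(q , suc zero) first lo =
  inj₁ (here refl , All¬⇒¬Any ((λ ()) ∷ lo≢hi X first ∷ (λ ()) ∷ []))
side-isSide X@(q , suc zero) first hi =
  inj₂ (All¬⇒¬Any (≢-sym (lo≢hi X first) ∷ (λ ()) ∷ (λ ()) ∷ []) , there (here refl))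
side-isSide X@(q , suc zero) second lo =
  inj₂ (All¬⇒¬Any ((λ ()) ∷ (λ ()) ∷ lo≢hi X second ∷ []) , there (there (here refl)))
side-isSide X@(q , suc zero) second hi =
  inj₁ (there (there (here refl)) , All¬⇒¬Any ((λ ()) ∷ (λ ()) ∷ ≢-sym (lo≢hi X second) ∷ []))
side-isSide X@(q , suc (suc zero)) first lo =
  inj₁ (there (here refl) , All¬⇒¬Any (lo≢hi X first ∷ (λ ()) ∷ (λ ()) ∷ []))
side-isSide X@(q , suc (suc zero)) first hi =
  inj₂ (All¬⇒¬Any ((λ ()) ∷ ≢-sym (lo≢hi X first) ∷ (λ ()) ∷ []) , here refl)
side-isSide X@(q , suc (suc zero)) second lo =
  inj₂ (All¬⇒¬Any ((λ ()) ∷ (λ ()) ∷ lo≢hi X second ∷ []) , there (there (here refl)))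
side-isSide X@(q , suc (suc zero)) second hi =
  inj₁ (there (there (here refl)) , All¬⇒¬Any ((λ ()) ∷ (λ ()) ∷ ≢-sym (lo≢hi X second) ∷ []))

partner₁-⊕u : ∀ q → partner q (suc zero) ⊕ u ≡ q
partner₁-⊕u (a , b) =
  cong₂ _,_ (trans (+-assoc a _ _) (+-identityʳ a)) (trans (+-identityʳ _) (+-identityʳ b))

partner₂-⊕v : ∀ q → partner q (suc (suc zero)) ⊕ v ≡ q
partner₂-⊕v (a , b) =
  cong₂ _,_ (trans (+-identityʳ _) (+-identityʳ a)) (trans (+-assoc b _ _) (+-identityʳ b))

isSide⇒side : ∀ {e} X → IsSide e X → ∃₂ λ p end → e ≡ side X p end
isSide⇒side (q , zero) (inj₁ (here refl , _))                  = first  , lo , refl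
isSide⇒side (q , zero) (inj₁ (there (here refl) , _))          = second , lo , refl
isSide⇒side (q , zero) (inj₁ (there (there (here refl)) , ∉₂)) = ⊥-elim (∉₂ (there (there (here refl))))
isSide⇒side (q , zero) (inj₂ (_ , here refl))                  = second , hi , refl
isSide⇒side (q , zero) (inj₂ (_ , there (here refl)))          = first  , hi , refl
isSide⇒side (q , zero) (inj₂ (∉₁ , there (there (here refl)))) = ⊥-elim (∉₁ (there (there (here refl))))
isSide⇒side (q , suc zero) (inj₁ (here refl , _))                  = first  , lo , refl
isSide⇒side (q , suc zero) (inj₁ (there (here refl) , ∉₂))         =
  ⊥-elim (∉₂ (here (cong (λ r → seg r (suc zero)) (sym (partner₁-⊕u q)))))
isSide⇒side (q , suc zero) (inj₁ (there (there (here refl)) , _))  = second , hi , refl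
isSide⇒side (q , suc zero) (inj₂ (∉₁ , here refl))                 =
  ⊥-elim (∉₁ (there (here (cong (λ r → seg r (suc zero)) (partner₁-⊕u q)))))
isSide⇒side (q , suc zero) (inj₂ (_ , there (here refl)))          = first  , hi , refl
isSide⇒side (q , suc zero) (inj₂ (_ , there (there (here refl))))  = second , lo , refl
isSide⇒side (q , suc (suc zero)) (inj₁ (here refl , ∉₂))                =
  ⊥-elim (∉₂ (there (here (cong (λ r → seg r zero) (sym (partner₂-⊕v q))))))
isSide⇒side (q , suc (suc zero)) (inj₁ (there (here refl) , _))         = first  , lo , refl
isSide⇒side (q , suc (suc zero)) (inj₁ (there (there (here refl)) , _)) = second , hi , refl
isSide⇒side (q , suc (suc zero)) (inj₂ (_ , here refl))                 = first  , hi , refl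
isSide⇒side (q , suc (suc zero)) (inj₂ (∉₁ , there (here refl)))        =
  ⊥-elim (∉₁ (here (cong (λ r → seg r zero) (partner₂-⊕v q))))
isSide⇒side (q , suc (suc zero)) (inj₂ (_ , there (there (here refl)))) = second , lo , refl

other-≢ : ∀ X p end → side X p end ≢ side X p (other end)
other-≢ X p lo = lo≢hi X p
other-≢ X p hi = ≢-sym (lo≢hi X p)

opposite⇒sides : ∀ {e f} X → Opposite e f X →
                 ∃₂ λ p end → e ≡ side X p end × f ≡ side X p (other end)
opposite⇒sides X (e-side , f-side , e≢f , e∥f) with isSide⇒side X e-side | isSide⇒side X f-side
... | p , end , refl | p′ , end′ , refl with pairDir-injective (proj₂ X) e∥f
opposite⇒sides X (_ , _ , e≢f , _) | p , lo , refl | p , lo , refl | refl = ⊥-elim (e≢f refl)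
opposite⇒sides X (_ , _ , e≢f , _) | p , hi , refl | p , hi , refl | refl = ⊥-elim (e≢f refl)
opposite⇒sides X _                 | p , lo , refl | p , hi , refl | refl = p , lo , refl , refl
opposite⇒sides X _                 | p , hi , refl | p , lo , refl | refl = p , hi , refl , refl

opposite-exists : ∀ {e} X → IsSide e X → ∃ λ f → Opposite e f X
opposite-exists X e-side with isSide⇒side X e-side
... | p , end , refl =
  side X p (other end) , e-side , side-isSide X p (other end) , other-≢ X p end , refl

parallel-side : ∀ {e f g} X → Opposite e f X → IsSide g X → Edge.dir g ≡ Edge.dir e → g ≡ e ⊎ g ≡ f
parallel-side X opp g-side g∥e with opposite⇒sides X opp | isSide⇒side X g-side
... | p , end , refl , refl | p′ , end′ , refl with pairDir-injective (proj₂ X) g∥e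
... | refl = same-pair end end′
  where
    same-pair : ∀ end end′ → side X p end′ ≡ side X p end ⊎ side X p end′ ≡ side X p (other end)
    same-pair lo lo = inj₁ refl
    same-pair lo hi = inj₂ refl
    same-pair hi lo = inj₂ refl
    same-pair hi hi = inj₁ refl

level-opposite : ∀ {e f} X → Opposite e f X → IsUnit (level f - level e)
level-opposite X opp with opposite⇒sides X opp
... | p , lo , refl , refl = proj₁ (successor-IsUnit (level (side X p lo)) (level-hi X p))
... | p , hi , refl , refl = proj₂ (successor-IsUnit (level (side X p lo)) (level-hi X p))

Opposite-sym : ∀ {e f X} → Opposite e f X → Opposite f e X
Opposite-sym (e-side , f-side , e≢f , e∥f) = f-side , e-side , ≢-sym e≢f , sym e∥f

sides : Tile → List Edge
sides X = side X first lo ∷ side X first hi ∷ side X second lo ∷ side X second hi ∷ []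

isSide⇒∈sides : ∀ {e} X → IsSide e X → e ∈ sides X
isSide⇒∈sides X e-side with isSide⇒side X e-side
... | first  , lo , refl = here refl
... | first  , hi , refl = there (here refl)
... | second , lo , refl = there (there (here refl))
... | second , hi , refl = there (there (there (here refl)))

Unique-sides-length≤4 : ∀ {X es} → Unique es → All (λ e → IsSide e X) es → length es ≤ 4
Unique-sides-length≤4 {X} unique all-sides =
  Unique-⊆⇒length≤ unique (All.map (isSide⇒∈sides X) all-sides)

_≟ᵀ_ : DecidableEquality Tile
_≟ᵀ_ = ≡-dec (≡-dec ℤ._≟_ ℤ._≟_) Fin._≟_

_≟ᴱ_ : DecidableEquality Edge
seg p d ≟ᴱ seg p′ d′ with ≡-dec ℤ._≟_ ℤ._≟_ p p′ | d Fin.≟ d′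
... | yes refl | yes refl = yes refl
... | no p≢p′  | _        = no (p≢p′ ∘ cong Edge.src)
... | yes _    | no d≢d′  = no (d≢d′ ∘ cong Edge.dir)

⊕-cancelʳ : ∀ p q r → p ⊕ r ≡ q ⊕ r → p ≡ q
⊕-cancelʳ (a , b) (a′ , b′) (x , y) eq =
  cong₂ _,_ (∙-cancelʳ x a a′ (cong proj₁ eq)) (∙-cancelʳ y b b′ (cong proj₂ eq))

up-edge-unique : ∀ {e} q q′ → e ∈ triEdges (up q) → e ∈ triEdges (up q′) → q ≡ q′
up-edge-unique q q′ (here refl)                 (here refl)               = refl
up-edge-unique q q′ (there (here refl))         (there (here refl))       = refl
up-edge-unique q q′ (there (there (here refl))) (there (there (here eq))) =
  ⊕-cancelʳ q q′ u (cong Edge.src eq)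
up-edge-unique q q′ (here refl)                 (there (here ()))
up-edge-unique q q′ (here refl)                 (there (there (here ())))
up-edge-unique q q′ (there (here refl))         (here ())
up-edge-unique q q′ (there (here refl))         (there (there (here ())))
up-edge-unique q q′ (there (there (here refl))) (here ())
up-edge-unique q q′ (there (there (here refl))) (there (here ()))

down-edge-unique : ∀ {e} r r′ → e ∈ triEdges (down r) → e ∈ triEdges (down r′) → r ≡ r′
down-edge-unique r r′ (here refl)                 (here eq)                 =
  ⊕-cancelʳ r r′ u (cong Edge.src eq)
down-edge-unique r r′ (there (here refl))         (there (here eq))         =
  ⊕-cancelʳ r r′ v (cong Edge.src eq)
down-edge-unique r r′ (there (there (here refl))) (there (there (here eq))) =
  ⊕-cancelʳ r r′ u (cong Edge.src eq)
down-edge-unique r r′ (here refl)                 (there (here ()))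
down-edge-unique r r′ (here refl)                 (there (there (here ())))
down-edge-unique r r′ (there (here refl))         (here ())
down-edge-unique r r′ (there (here refl))         (there (there (here ())))
down-edge-unique r r′ (there (there (here refl))) (here ())
down-edge-unique r r′ (there (there (here refl))) (there (here ()))

∈-mapL⁺ : ∀ {A B : Set} (f : A → B) {x xs} → x ∈ xs → f x ∈ mapL f xs
∈-mapL⁺ f (here refl) = here refl
∈-mapL⁺ f (there x∈xs) = there (∈-mapL⁺ f x∈xs)

side∈faces : ∀ {e} X → IsSide e X → edg e ∈ faces X
side∈faces X (inj₁ (e∈₁ , _)) =
  ∈-++⁺ˡ (there (∈-++⁺ˡ {ys = mapL vtx (triVerts (tri₁ X))} (∈-mapL⁺ edg e∈₁)))
side∈faces X (inj₂ (_ , e∈₂)) =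
  ∈-++⁺ʳ (triFaces (tri₁ X)) (there (∈-++⁺ˡ {ys = mapL vtx (triVerts (tri₂ X))} (∈-mapL⁺ edg e∈₂)))

P2⇒¬common-tri : ∀ {T U t} → P2 T U → ¬ Common T U (tri t)
P2⇒¬common-tri (inj₁ disjoint) common = disjoint _ common
P2⇒¬common-tri (inj₂ (inj₁ (_ , meet))) common with proj₁ (meet _) common
... | ()
P2⇒¬common-tri (inj₂ (inj₂ (_ , _ , _ , meet))) common with proj₁ (meet _) common
... | here ()
... | there (here ())
... | there (there (here ()))

P2⇒common-edge-unique : ∀ {T U a b} → P2 T U → Common T U (edg a) → Common T U (edg b) → a ≡ b
P2⇒common-edge-unique (inj₁ disjoint) common _ = ⊥-elim (disjoint _ common)
P2⇒common-edge-unique (inj₂ (inj₁ (_ , meet))) common _ with proj₁ (meet _) common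
... | ()
P2⇒common-edge-unique (inj₂ (inj₂ (_ , _ , _ , meet))) commonᵃ commonᵇ
  with proj₁ (meet _) commonᵃ | proj₁ (meet _) commonᵇ
... | here refl               | here refl               = refl
... | there (here ())         | _
... | there (there (here ())) | _
... | here refl               | there (here ())
... | here refl               | there (there (here ()))

P2⇒¬shared-up-edge : ∀ {e T U} → P2 T U → e ∈ triEdges (tri₁ T) → e ∉ triEdges (tri₁ U)
P2⇒¬shared-up-edge {T = q , _} {q′ , _} p2 e∈T e∈U with up-edge-unique q q′ e∈T e∈U
... | refl = P2⇒¬common-tri p2 (here refl , here refl)

P2⇒¬shared-down-edge : ∀ {e T U} → P2 T U → e ∈ triEdges (tri₂ T) → e ∉ triEdges (tri₂ U)
P2⇒¬shared-down-edge {T = T} {U} p2 e∈T e∈U with down-edge-unique _ _ e∈T e∈U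
... | eq = P2⇒¬common-tri p2 (∈-++⁺ʳ (triFaces (tri₁ T)) (here refl) ,
                              ∈-++⁺ʳ (triFaces (tri₁ U)) (here (cong (tri ∘ down) eq)))

P2-shared-side : ∀ {e T U} → P2 T U → IsSide e T → IsSide e U →
                 (e ∈ triEdges (tri₁ T) × e ∈ triEdges (tri₂ U)) ⊎
                 (e ∈ triEdges (tri₂ T) × e ∈ triEdges (tri₁ U))
P2-shared-side p2 (inj₁ (e∈T , _)) (inj₁ (e∈U , _)) = ⊥-elim (P2⇒¬shared-up-edge p2 e∈T e∈U)
P2-shared-side p2 (inj₁ (e∈T , _)) (inj₂ (_ , e∈U)) = inj₁ (e∈T , e∈U)
P2-shared-side p2 (inj₂ (_ , e∈T)) (inj₁ (e∈U , _)) = inj₂ (e∈T , e∈U)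
P2-shared-side p2 (inj₂ (_ , e∈T)) (inj₂ (_ , e∈U)) = ⊥-elim (P2⇒¬shared-down-edge p2 e∈T e∈U)

side∉both-triangles : ∀ {e X} → IsSide e X → e ∈ triEdges (tri₁ X) → e ∉ triEdges (tri₂ X)
side∉both-triangles (inj₁ (_ , ∉₂)) _   = ∉₂
side∉both-triangles (inj₂ (∉₁ , _)) e∈₁ = ⊥-elim (∉₁ e∈₁)

P2⇒¬side-shared-by-three : ∀ {e X U V} → P2 X U → P2 X V → P2 U V →
                           IsSide e X → IsSide e U → ¬ IsSide e V
P2⇒¬side-shared-by-three {X = X} pXU pXV pUV eX eU eV
  with P2-shared-side pXU eX eU | P2-shared-side pXV eX eV
... | inj₁ (_ , e∈U)  | inj₁ (_ , e∈V)  = P2⇒¬shared-down-edge pUV e∈U e∈V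
... | inj₂ (_ , e∈U)  | inj₂ (_ , e∈V)  = P2⇒¬shared-up-edge pUV e∈U e∈V
... | inj₁ (e∈X₁ , _) | inj₂ (e∈X₂ , _) = side∉both-triangles {X = X} eX e∈X₁ e∈X₂
... | inj₂ (e∈X₂ , _) | inj₁ (e∈X₁ , _) = side∉both-triangles {X = X} eX e∈X₁ e∈X₂

module Tiling (tiles : List Tile) (tredoku : Tredoku tiles) where
  open Tredoku tredoku

  Occupies : Tile → Tile → Edge → Set
  Occupies X U e = U ∈ tiles × U ≢ X × IsSide e U

  Occupied : Tile → Edge → Set
  Occupied X e = ∃ λ U → Occupies X U e

  FreeSide : Tile → Edge → Set
  FreeSide X e = IsSide e X × ¬ Occupied X e

  shared-side-unique : ∀ {X U a b} → X ∈ tiles → U ∈ tiles → X ≢ U →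
                       IsSide a X → IsSide a U → IsSide b X → IsSide b U → a ≡ b
  shared-side-unique {X} {U} X∈ U∈ X≢U aX aU bX bU =
    P2⇒common-edge-unique (P2-holds X U X∈ U∈ X≢U)
      (side∈faces X aX , side∈faces U aU) (side∈faces X bX , side∈faces U bU)

  no-side-shared-by-three : ∀ {e X U V} → X ∈ tiles → U ∈ tiles → V ∈ tiles →
                            X ≢ U → X ≢ V → U ≢ V → IsSide e X → IsSide e U → ¬ IsSide e V
  no-side-shared-by-three X∈ U∈ V∈ X≢U X≢V U≢V = P2⇒¬side-shared-by-three
    (P2-holds _ _ X∈ U∈ X≢U) (P2-holds _ _ X∈ V∈ X≢V) (P2-holds _ _ U∈ V∈ U≢V)

  occupant-unique : ∀ {X U U′ e} → X ∈ tiles → IsSide e X → Occupies X U e → Occupies X U′ e → U ≡ U′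
  occupant-unique {U = U} {U′} X∈ eX (U∈ , U≢X , eU) (U′∈ , U′≢X , eU′) with U ≟ᵀ U′
  ... | yes U≡U′ = U≡U′
  ... | no U≢U′  =
    ⊥-elim (no-side-shared-by-three X∈ U∈ U′∈ (≢-sym U≢X) (≢-sym U′≢X) U≢U′ eX eU eU′)

  occupied-sides : ∀ {X n} → X ∈ tiles → Degree tiles X n →
                   ∃[ S ] (Unique S × length S ≡ n × All (λ e → IsSide e X × Occupied X e) S)
  occupied-sides {X} X∈ (L , unique-L , refl , neighbour) =
    let S , unique-S , length-S , sources =
          Unique-image SharedWith (λ (eX , occ) (_ , occ′) → occupant-unique X∈ eX occ occ′)
                       unique-L (All.tabulate shared-side)
    in S , unique-S , length-S , All.map (λ (U , _ , eX , occ) → eX , U , occ) sources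
    where
      SharedWith : Tile → Edge → Set
      SharedWith U e = IsSide e X × Occupies X U e

      shared-side : ∀ {U} → U ∈ L → ∃ (SharedWith U)
      shared-side {U} U∈L with proj₁ (neighbour U) U∈L
      ... | U∈ , X≢U , e , eX , eU = e , eX , U∈ , ≢-sym X≢U , eU

  degree+free≤4 : ∀ {X n F} → X ∈ tiles → Degree tiles X n → Unique F → All (FreeSide X) F →
                  n + length F ≤ 4
  degree+free≤4 {X} {F = F} X∈ deg unique-F free =
    let S , unique-S , length-S , occupied = occupied-sides X∈ deg
        disjoint : ∀ {e} → ¬ (e ∈ S × e ∈ F)
        disjoint (e∈S , e∈F) = proj₂ (All.lookup free e∈F) (proj₂ (All.lookup occupied e∈S))
    in subst (_≤ 4) (trans (length-++ S) (cong (_+ length F) length-S))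
         (Unique-sides-length≤4 {X} (Uniqueₚ.++⁺ unique-S unique-F disjoint)
           (Allₚ.++⁺ (All.map proj₁ occupied) (All.map proj₁ free)))

  degree4⇒¬free : ∀ {X e} → X ∈ tiles → Degree tiles X 4 → ¬ FreeSide X e
  degree4⇒¬free X∈ deg₄ free = <-irrefl refl (degree+free≤4 X∈ deg₄ ([] ∷ []) (free ∷ []))

  spine-free-side-unique : ∀ {X a b} → InSpine tiles X → FreeSide X a → FreeSide X b → a ≡ b
  spine-free-side-unique {a = a} {b} (X∈ , deg) free-a free-b with a ≟ᴱ b | deg
  ... | yes a≡b | _          = a≡b
  ... | no a≢b  | inj₁ deg₃ =
    ⊥-elim (<-irrefl refl (degree+free≤4 X∈ deg₃ ((a≢b ∷ []) ∷ [] ∷ []) (free-a ∷ free-b ∷ [])))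
  ... | no _    | inj₂ deg₄ = ⊥-elim (degree4⇒¬free X∈ deg₄ free-a)

  chain-length≤tiles : ∀ {c} → IsChain tiles c → length c ≤ length tiles
  chain-length≤tiles (_ , c⊆tiles , unique , _) = Unique-⊆⇒length≤ unique c⊆tiles

  -- P45 only constrains maximal chains.  A chain longer than 3 is maximal unless a proper extension is
  -- a longer chain; slack bounds how often that can happen, as no chain is longer than the tiling.
  chain-length≤3 : ∀ {c} → IsChain tiles c → length c ≤ 3
  chain-length≤3 {c} chain = ≮⇒≥ (bounded (length tiles) (m≤m+n (length tiles) (length c)) chain)
    where
      bounded : ∀ slack {c} → length tiles ≤ slack + length c → IsChain tiles c → ¬ 3 < length c
      bounded slack {c} bound chain 3<c = <-irrefl (sym (P45 c (chain , maximal))) 3<c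
        where
          no-longer-chain : ∀ slack {c′} → length tiles ≤ slack + length c → IsChain tiles c′ →
                          length c < length c′ → ⊥
          no-longer-chain zero        bound chain′ longer =
            <⇒≱ (≤-<-trans bound longer) (chain-length≤tiles chain′)
          no-longer-chain (suc slack′) {c′} bound chain′ longer =
            bounded slack′ bound′ chain′ (<-trans 3<c longer)
            where
              open ≤-Reasoning
              bound′ : length tiles ≤ slack′ + length c′
              bound′ = begin
                length tiles             ≤⟨ bound ⟩
                suc slack′ + length c    ≡⟨ sym (+-suc slack′ (length c)) ⟩
                slack′ + suc (length c)  ≤⟨ +-monoʳ-≤ slack′ longer ⟩
                slack′ + length c′       ∎

          maximal : ∀ pre suf → IsChain tiles (pre ++ c ++ suf) → pre ≡ [] × suf ≡ []
          maximal pre suf chain′ with extension-trivial⊎longer pre c suf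
          ... | inj₁ trivial = trivial
          ... | inj₂ longer  = ⊥-elim (no-longer-chain slack bound chain′ longer)

  far-side-free : ∀ {P Q g g′ h} → P ∈ tiles → Q ∈ tiles → P ≢ Q →
                  Opposite g g′ P → Opposite g h Q → Occupied P g′ → ¬ Occupied Q h
  far-side-free {P} {Q} {g} {g′} {h} P∈ Q∈ P≢Q
                opP@(gP , g′P , g≢g′ , g∥g′) opQ@(gQ , hQ , g≢h , g∥h)
                (Z , Z∈ , Z≢P , g′Z) (W , W∈ , W≢Q , hW) =
    <-irrefl refl (chain-length≤3 run-of-four)
    where
      W≢P : W ≢ P
      W≢P refl = g≢h (shared-side-unique P∈ Q∈ P≢Q gP gQ hW hQ)

      Q≢Z : Q ≢ Z
      Q≢Z refl = g≢g′ (shared-side-unique P∈ Q∈ P≢Q gP gQ g′P g′Z)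

      -- Otherwise h, g and g′ would lie on three pairwise adjacent parallel lattice lines.
      W≢Z : W ≢ Z
      W≢Z refl with h ≟ᴱ g′
      ... | yes refl = no-side-shared-by-three P∈ Q∈ W∈ P≢Q (≢-sym W≢P) (≢-sym W≢Q) g′P hQ hW
      ... | no h≢g′  = no-unit-triangle (level h) (level g) (level g′)
                         (level-opposite Q (Opposite-sym {X = Q} opQ)) (level-opposite P opP)
                         (level-opposite W (hW , g′Z , h≢g′ , trans (sym g∥h) g∥g′))

      run-of-four : IsChain tiles (W ∷ Q ∷ P ∷ Z ∷ [])
      run-of-four =
        s≤s (s≤s z≤n) , (W∈ ∷ Q∈ ∷ P∈ ∷ Z∈ ∷ []) ,
        ((W≢Q ∷ W≢P ∷ W≢Z ∷ []) ∷ (≢-sym P≢Q ∷ Q≢Z ∷ []) ∷ (≢-sym Z≢P ∷ []) ∷ [] ∷ []) ,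
        Edge.dir g , (h ∷ g ∷ g′ ∷ []) ,
        link hW hQ (sym g∥h) tt
          (link gQ gP refl (Opposite-sym {X = Q} opQ)
            (link g′P g′Z (sym g∥g′) opP last))

  module _ {T : Tile} (T∈ : T ∈ tiles) (T-deg₄ : Degree tiles T 4) where

    data Reached : Tile → Set where
      start : Reached T
      enter : ∀ {P Q e f} → Reached P → Occupies Q P e → InSpine tiles Q → Opposite e f Q →
              ¬ Occupied Q f → Reached Q

    enter-across : ∀ {P Q g g′} → Reached P → P ∈ tiles → P ≢ Q → InSpine tiles Q → IsSide g Q →
                   Opposite g g′ P → ¬ FreeSide P g′ → Reached Q
    enter-across {Q = Q} reached P∈ P≢Q spineQ@(Q∈ , _) gQ opP@(gP , g′P , _) g′-not-free
      with opposite-exists Q gQ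
    ... | h , opQ = enter reached (P∈ , P≢Q , gP) spineQ opQ h-free
      where
        h-free : ¬ Occupied Q h
        h-free h-occupied =
          g′-not-free (g′P , λ g′-occupied → far-side-free P∈ Q∈ P≢Q opP opQ g′-occupied h-occupied)

    reached-step : ∀ {P Q} → Reached P → Adjacent P Q → InSpine tiles Q → Reached Q
    reached-step start (T≢Q , g , gT , gQ) spineQ with opposite-exists T gT
    ... | g′ , opT = enter-across start T∈ T≢Q spineQ gQ opT (degree4⇒¬free T∈ T-deg₄)
    reached-step {P} {Q}
                 reached@(enter {e = e} {f} reached′ occ spineP@(P∈ , _) opP@(_ , fP , _ , e∥f) f-free)
                 (P≢Q , g , gP , gQ) spineQ@(Q∈ , _)
      with g ≟ᴱ e | g ≟ᴱ f
    ... | yes refl | _        = subst Reached (occupant-unique P∈ gP occ (Q∈ , ≢-sym P≢Q , gQ)) reached′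
    ... | no _     | yes refl = ⊥-elim (f-free (Q , Q∈ , ≢-sym P≢Q , gQ))
    ... | no g≢e   | no g≢f with opposite-exists P gP
    ...   | g′ , opg@(_ , _ , _ , g∥g′) = enter-across reached P∈ P≢Q spineQ gQ opg g′-not-free
      where
        g′≢f : g′ ≢ f
        g′≢f refl = [ g≢e , g≢f ]′ (parallel-side P opP gP (trans g∥g′ (sym e∥f)))

        g′-not-free : ¬ FreeSide P g′
        g′-not-free g′-free = g′≢f (spine-free-side-unique spineP g′-free (fP , f-free))

    reached-along : ∀ {X Y} → Reach (InSpine tiles) Adjacent X Y → Reached X → Reached Y
    reached-along here                  reached = reached
    reached-along (step adj spine path) reached = reached-along path (reached-step reached adj spine)

    reached-degree4⇒start : ∀ {X} → Reached X → Degree tiles X 4 → X ≡ T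
    reached-degree4⇒start start                                  _    = refl
    reached-degree4⇒start (enter _ _ (X∈ , _) (_ , fX , _) f-free) deg₄ =
      ⊥-elim (degree4⇒¬free X∈ deg₄ (fX , f-free))

    degree4-unique : Irreducible tiles → ∀ {T′} → T′ ∈ tiles → Degree tiles T′ 4 → T′ ≡ T
    degree4-unique irreducible {T′} T′∈ T′-deg₄ =
      reached-degree4⇒start (reached-along spine-path start) T′-deg₄
      where
        spine-path : Reach (InSpine tiles) Adjacent T T′
        spine-path = irreducible T T′ (T∈ , inj₂ T-deg₄) (T′∈ , inj₂ T′-deg₄)

lemma7 : (tiles : List Tile) → Tredoku tiles → Irreducible tiles →
    (L : List Tile) → FourTiles tiles L → length L ≡ 0 ⊎ length L ≡ 1
lemma7 tiles tredoku irreducible []           _ = inj₁ refl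
lemma7 tiles tredoku irreducible (_ ∷ [])     _ = inj₂ refl
lemma7 tiles tredoku irreducible (T ∷ T′ ∷ _) (((T≢T′ ∷ _) ∷ _) , four-tiles)
  with proj₁ (four-tiles T) (here refl) | proj₁ (four-tiles T′) (there (here refl))
... | T∈ , T-deg₄ | T′∈ , T′-deg₄ =
  ⊥-elim (T≢T′ (sym (Tiling.degree4-unique tiles tredoku T∈ T-deg₄ irreducible T′∈ T′-deg₄)))
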